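{- Let $\pi_1=s_1s_2s_1\in W(A_2)$. Up to isomorphism of root systems preserving positive roots, the elements $\sigma\in W(\Theta)$, for $\Theta$ an irreducible finite crystallographic root system of rank at most $2$, that contain the linear pattern $\pi_1$ are exactly: $s_1s_2s_1\in W(A_2)$; $s_2s_1s_2$ and $s_1s_2s_1s_2$ in $W(B_2)$; and $s_2s_1s_2$, $s_1s_2s_1s_2$, $s_2s_1s_2s_1$, $s_1s_2s_1s_2s_1$, $s_2s_1s_2s_1s_2$, $s_1s_2s_1s_2s_1s_2$ in $W(G_2)$.
   Context: $I_\Theta(\sigma)=\{\beta\in\Theta^+:\sigma\beta\notin\Theta^+\}$. $\sigma\in W(\Theta)$ contains the linear pattern $\pi\in W(R)$ if there is a linear map from the span of $R$ to the span of $\Theta$ sending $R^+$ into $\Theta^+$, $I_R(\pi)$ into $I_\Theta(\sigma)$, and $R^+\setminus I_R(\pi)$ into $\Theta^+\setminus I_\Theta(\sigma)$. Labelling: in $B_2$, $\alpha_1$ is the long simple root and $\alpha_2$ the short one (positive roots $\alpha_1,\alpha_2,\alpha_1+\alpha_2,\alpha_1+2\alpha_2$); in $G_2$, $\alpha_1$ is long and $\alpha_2$ short (positive roots $\alpha_1,\alpha_2,\alpha_1+\alpha_2,\alpha_1+2\alpha_2,\alpha_1+3\alpha_2,2\alpha_1+3\alpha_2$); $s_i$ is the reflection in $\alpha_i$. -}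

module Defs where

open import Data.Nat using (ℕ)
open import Data.Integer using (ℤ; +_; -[1+_]; _+_; _-_; _*_; 0ℤ)
open import Data.Fin using (Fin; zero; suc; _≟_)
open import Data.Vec using (Vec; []; _∷_; lookup; tabulate; foldr)
open import Data.List using (List; []; _∷_)
open import Data.List.Membership.Propositional using (_∈_)
open import Data.List.Relation.Unary.Any using (Any)
open import Data.Product using (Σ; _×_)
open import Relation.Nullary using (¬_; yes; no)
open import Relation.Binary.PropositionalEquality using (_≡_)

-- Irreducible finite crystallographic root systems of rank ≤ 2, up to
-- isomorphism (rank 1: A1; rank 2: A2, B2, G2).
data Type : Set where
  A1 A2 B2 G2 : Type

rank : Type → ℕ
rank A1 = 1
rank A2 = 2
rank B2 = 2
rank G2 = 2

-- Vectors are written in coordinates with respect to the simple roots.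
Vect : Type → Set
Vect t = Vec ℤ (rank t)

-- Cartan matrix: cartan t i j = ⟨α_i , α_j^∨⟩ = 2(α_i,α_j)/(α_j,α_j).
-- B2, G2: α₁ = zero is long, α₂ = suc zero is short.
cartan : (t : Type) → Fin (rank t) → Fin (rank t) → ℤ
cartan A1 zero zero = + 2
cartan A2 zero zero = + 2
cartan A2 zero (suc zero) = -[1+ 0 ]
cartan A2 (suc zero) zero = -[1+ 0 ]
cartan A2 (suc zero) (suc zero) = + 2
cartan B2 zero zero = + 2
cartan B2 zero (suc zero) = -[1+ 1 ]
cartan B2 (suc zero) zero = -[1+ 0 ]
cartan B2 (suc zero) (suc zero) = + 2
cartan G2 zero zero = + 2
cartan G2 zero (suc zero) = -[1+ 2 ]
cartan G2 (suc zero) zero = -[1+ 0 ]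
cartan G2 (suc zero) (suc zero) = + 2

posRoots : (t : Type) → List (Vect t)
posRoots A1 = (+ 1 ∷ []) ∷ []
posRoots A2 = (+ 1 ∷ + 0 ∷ []) ∷ (+ 0 ∷ + 1 ∷ []) ∷ (+ 1 ∷ + 1 ∷ []) ∷ []
posRoots B2 = (+ 1 ∷ + 0 ∷ []) ∷ (+ 0 ∷ + 1 ∷ []) ∷ (+ 1 ∷ + 1 ∷ [])
            ∷ (+ 1 ∷ + 2 ∷ []) ∷ []
posRoots G2 = (+ 1 ∷ + 0 ∷ []) ∷ (+ 0 ∷ + 1 ∷ []) ∷ (+ 1 ∷ + 1 ∷ [])
            ∷ (+ 1 ∷ + 2 ∷ []) ∷ (+ 1 ∷ + 3 ∷ []) ∷ (+ 2 ∷ + 3 ∷ []) ∷ []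

Pos : (t : Type) → Vect t → Set
Pos t v = v ∈ posRoots t

pairing : (t : Type) → Vect t → Fin (rank t) → ℤ
pairing t v i = foldr (λ _ → ℤ) _+_ 0ℤ (tabulate (λ j → lookup v j * cartan t j i))

refl : (t : Type) → Fin (rank t) → Vect t → Vect t
refl t i v = tabulate (λ j → lookup v j - coeff j)
  where
  coeff : Fin (rank t) → ℤ
  coeff j with j ≟ i
  ... | yes _ = pairing t v i
  ... | no _ = 0ℤ

-- Elements of W(Θ) are given by words in the simple reflections;
-- the word i₁ i₂ … iₖ denotes s_{i₁} s_{i₂} ⋯ s_{iₖ}.
Word : Type → Set
Word t = List (Fin (rank t))

act : (t : Type) → Word t → Vect t → Vect t
act t [] v = v
act t (i ∷ w) v = refl t i (act t w v)

-- equality of Weyl group elements (the reflection representation is faithful)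
_≈W_ : {t : Type} → Word t → Word t → Set
_≈W_ {t} w w' = (v : Vect t) → act t w v ≡ act t w' v

Inv : (t : Type) → Word t → Vect t → Set
Inv t σ β = Pos t β × ¬ Pos t (act t σ β)

-- A linear map span R → span Θ, given by the images of the simple roots of R.
LinMap : Type → Type → Set
LinMap r t = Fin (rank r) → Vect t

applyLin : {r t : Type} → LinMap r t → Vect r → Vect t
applyLin {r} {t} f β =
  tabulate (λ k → foldr (λ _ → ℤ) _+_ 0ℤ (tabulate (λ i → lookup β i * lookup (f i) k)))

ContainsPattern : (r : Type) → Word r → (t : Type) → Word t → Set
ContainsPattern r π t σ =
  Σ (LinMap r t) λ f → (β : Vect r) → Pos r β →
      Pos t (applyLin f β)
    × (Inv r π β → Inv t σ (applyLin f β))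
    × (¬ Inv r π β → ¬ Inv t σ (applyLin f β))

s₁ s₂ : Fin 2
s₁ = zero
s₂ = suc zero

π₁ : Word A2
π₁ = s₁ ∷ s₂ ∷ s₁ ∷ []

listed : (t : Type) → List (Word t)
listed A1 = []
listed A2 = (s₁ ∷ s₂ ∷ s₁ ∷ []) ∷ []
listed B2 = (s₂ ∷ s₁ ∷ s₂ ∷ []) ∷ (s₁ ∷ s₂ ∷ s₁ ∷ s₂ ∷ []) ∷ []
listed G2 = (s₂ ∷ s₁ ∷ s₂ ∷ [])
          ∷ (s₁ ∷ s₂ ∷ s₁ ∷ s₂ ∷ [])
          ∷ (s₂ ∷ s₁ ∷ s₂ ∷ s₁ ∷ [])
          ∷ (s₁ ∷ s₂ ∷ s₁ ∷ s₂ ∷ s₁ ∷ [])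
          ∷ (s₂ ∷ s₁ ∷ s₂ ∷ s₁ ∷ s₂ ∷ [])
          ∷ (s₁ ∷ s₂ ∷ s₁ ∷ s₂ ∷ s₁ ∷ s₂ ∷ [])
          ∷ []

Listed : (t : Type) → Word t → Set
Listed t σ = Any (λ τ → σ ≈W τ) (listed t)

-- π₁ = s₁s₂s₁ is the longest element of W(A₂), so it inverts all three positive roots
-- α₁, α₂, α₁ + α₂.  Hence σ contains π₁ exactly when there are β, γ with β, γ and β + γ
-- all in I_Θ(σ): take β and γ to be the images of α₁ and α₂.  In A₁ no two positive roots
-- add up to a root.  In rank 2 this condition depends on σ only as an element of W(Θ),
-- which acts linearly and is therefore determined by its values on the simple roots;
-- W(Θ) is dihedral of order 6, 8 or 12, and checking the condition on each of its
-- elements produces the list.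
module Submission where

open import Data.Empty using (⊥-elim)
open import Data.Fin using (Fin; zero; suc)
import Data.Fin.Properties as Fin
open import Data.Integer using (ℤ; +_; -[1+_]; _+_; _-_; _*_; 0ℤ)
import Data.Integer as ℤ
open import Data.Integer.Tactic.RingSolver using (solve-∀)
open import Data.List using (List; []; _∷_)
open import Data.List.Membership.Propositional using (find; lose)
open import Data.List.Relation.Unary.All as All using (All; all?)
open import Data.List.Relation.Unary.Any as Any using (Any; here; there; any?; satisfied)
open import Data.Product using (∃₂; _×_; _,_; proj₁; proj₂)
open import Data.Vec using (Vec; []; _∷_; lookup; tabulate; zipWith; map)
import Data.Vec.Properties as Vec
open import Function using (_∘_; _∋_; const)
open import Function.Bundles using (_⇔_; mk⇔; Equivalence)
import Function.Properties.Equivalence as ⇔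
open import Relation.Binary.PropositionalEquality
  using (_≡_; refl; sym; trans; cong; cong₂; subst; module ≡-Reasoning)
open import Relation.Nullary using (¬_; Dec; yes; no)
open import Relation.Nullary.Decidable using (_×-dec_; ¬?; map′; from-yes)

open import Defs renaming (refl to reflect)

infixl 6 _+ᵛ_
infixl 7 _*ᵛ_

_+ᵛ_ : ∀ {n} → Vec ℤ n → Vec ℤ n → Vec ℤ n
_+ᵛ_ = zipWith _+_

_*ᵛ_ : ∀ {n} → ℤ → Vec ℤ n → Vec ℤ n
x *ᵛ v = map (x *_) v

_≟ᵛ_ : ∀ {n} (u v : Vec ℤ n) → Dec (u ≡ v)
_≟ᵛ_ = Vec.≡-dec ℤ._≟_

_⇔?_ : ∀ {A B : Set} → Dec A → Dec B → Dec (A ⇔ B)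
yes a ⇔? yes b = yes (mk⇔ (const b) (const a))
yes a ⇔? no ¬b = no λ a⇔b → ¬b (Equivalence.to a⇔b a)
no ¬a ⇔? yes b = no λ a⇔b → ¬a (Equivalence.from a⇔b b)
no ¬a ⇔? no ¬b = yes (mk⇔ (⊥-elim ∘ ¬a) (⊥-elim ∘ ¬b))

pos? : (t : Type) (v : Vect t) → Dec (Pos t v)
pos? t v = any? (v ≟ᵛ_) (posRoots t)

inv? : (t : Type) (σ : Word t) (β : Vect t) → Dec (Inv t σ β)
inv? t σ β = pos? t β ×-dec ¬? (pos? t (act t σ β))

InvertedSum : (t : Type) → Word t → Vect t → Vect t → Set
InvertedSum t σ β γ = Inv t σ β × Inv t σ γ × Inv t σ (β +ᵛ γ)

InvertsSumTriple : (t : Type) → Word t → Set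
InvertsSumTriple t σ = ∃₂ (InvertedSum t σ)

invertsSumTriple? : (t : Type) (σ : Word t) → Dec (InvertsSumTriple t σ)
invertsSumTriple? t σ = map′ fromAny toAny
  (any? (λ β → any? (λ γ → inv? t σ β ×-dec inv? t σ γ ×-dec inv? t σ (β +ᵛ γ))
                    (posRoots t))
        (posRoots t))
  where
  fromAny : Any (λ β → Any (InvertedSum t σ β) (posRoots t)) (posRoots t) →
            InvertsSumTriple t σ
  fromAny triples with satisfied triples
  ... | β , sums with satisfied sums
  ...   | γ , inverted = β , γ , inverted
  toAny : InvertsSumTriple t σ →
          Any (λ β → Any (InvertedSum t σ β) (posRoots t)) (posRoots t)
  toAny (β , γ , inverted@((β⁺ , _) , (γ⁺ , _) , _)) = lose β⁺ (lose γ⁺ inverted)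

π₁-inverts-positive : ∀ {β} → Pos A2 β → Inv A2 π₁ β
π₁-inverts-positive = All.lookup (from-yes (all? (inv? A2 π₁) (posRoots A2)))

tabulate-≗-lookup : ∀ {n} {F : Fin n → ℤ} (v : Vec ℤ n) → (∀ k → F k ≡ lookup v k) →
                    tabulate F ≡ v
tabulate-≗-lookup v F≗v = trans (Vec.tabulate-cong F≗v) (Vec.tabulate∘lookup v)

module _ {t : Type} (f : LinMap A2 t) where

  private
    p = f zero
    q = f (suc zero)

  applyLin-α₁ : applyLin {A2} {t} f (+ 1 ∷ + 0 ∷ []) ≡ p
  applyLin-α₁ = tabulate-≗-lookup p λ k → identity (lookup p k) (lookup q k)
    where
    identity : ∀ a b → + 1 * a + (+ 0 * b + 0ℤ) ≡ a
    identity = solve-∀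

  applyLin-α₂ : applyLin {A2} {t} f (+ 0 ∷ + 1 ∷ []) ≡ q
  applyLin-α₂ = tabulate-≗-lookup q λ k → identity (lookup p k) (lookup q k)
    where
    identity : ∀ a b → + 0 * a + (+ 1 * b + 0ℤ) ≡ b
    identity = solve-∀

  applyLin-α₁+α₂ : applyLin {A2} {t} f (+ 1 ∷ + 1 ∷ []) ≡ p +ᵛ q
  applyLin-α₁+α₂ = tabulate-≗-lookup (p +ᵛ q) λ k →
    trans (identity (lookup p k) (lookup q k)) (sym (Vec.lookup-zipWith _+_ k p q))
    where
    identity : ∀ a b → + 1 * a + (+ 1 * b + 0ℤ) ≡ a + b
    identity = solve-∀

containsπ₁⇔invertsSumTriple : (t : Type) (σ : Word t) →
                              ContainsPattern A2 π₁ t σ ⇔ InvertsSumTriple t σ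
containsπ₁⇔invertsSumTriple t σ = mk⇔ to from
  where
  to : ContainsPattern A2 π₁ t σ → InvertsSumTriple t σ
  to (f , image) =
    f zero , f (suc zero) ,
    inverted (here refl) (applyLin-α₁ f) ,
    inverted (there (here refl)) (applyLin-α₂ f) ,
    inverted (there (there (here refl))) (applyLin-α₁+α₂ f)
    where
    inverted : ∀ {β v} → Pos A2 β → applyLin {A2} {t} f β ≡ v → Inv t σ v
    inverted β⁺ fβ≡v =
      subst (Inv t σ) fβ≡v (proj₁ (proj₂ (image _ β⁺)) (π₁-inverts-positive β⁺))

  from : InvertsSumTriple t σ → ContainsPattern A2 π₁ t σ
  from (p , q , p⁻ , q⁻ , p+q⁻) = f , image
    where
    f : LinMap A2 t
    f zero = p
    f (suc zero) = q
    inverted : ∀ {β} → Pos A2 β → Inv t σ (applyLin {A2} {t} f β)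
    inverted (here refl) = subst (Inv t σ) (sym (applyLin-α₁ f)) p⁻
    inverted (there (here refl)) = subst (Inv t σ) (sym (applyLin-α₂ f)) q⁻
    inverted (there (there (here refl))) = subst (Inv t σ) (sym (applyLin-α₁+α₂ f)) p+q⁻
    image : (β : Vect A2) → Pos A2 β →
            Pos t (applyLin {A2} {t} f β)
          × (Inv A2 π₁ β → Inv t σ (applyLin {A2} {t} f β))
          × (¬ Inv A2 π₁ β → ¬ Inv t σ (applyLin {A2} {t} f β))
    image β β⁺ = proj₁ fβ⁻ , const fβ⁻ , λ β∉I → ⊥-elim (β∉I (π₁-inverts-positive β⁺))
      where
      fβ⁻ : Inv t σ (applyLin {A2} {t} f β)
      fβ⁻ = inverted β⁺

module _ {t : Type} where

  ≈W-sym : {σ τ : Word t} → σ ≈W τ → τ ≈W σ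
  ≈W-sym σ≈τ v = sym (σ≈τ v)

  ≈W-trans : {σ τ υ : Word t} → σ ≈W τ → τ ≈W υ → σ ≈W υ
  ≈W-trans σ≈τ τ≈υ v = trans (σ≈τ v) (τ≈υ v)

  ∷-cong-≈W : (i : Fin (rank t)) {σ τ : Word t} → σ ≈W τ → (i ∷ σ) ≈W (i ∷ τ)
  ∷-cong-≈W i σ≈τ v = cong (reflect t i) (σ≈τ v)

  Inv-resp-≈W : {σ τ : Word t} → σ ≈W τ → ∀ {β} → Inv t σ β → Inv t τ β
  Inv-resp-≈W σ≈τ {β} (β⁺ , σβ∉Θ⁺) = β⁺ , σβ∉Θ⁺ ∘ subst (Pos t) (sym (σ≈τ β))

  InvertsSumTriple-resp-≈W : {σ τ : Word t} → σ ≈W τ →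
                             InvertsSumTriple t σ → InvertsSumTriple t τ
  InvertsSumTriple-resp-≈W {σ} {τ} σ≈τ (β , γ , β⁻ , γ⁻ , β+γ⁻) =
    β , γ , resp β⁻ , resp γ⁻ , resp β+γ⁻
    where
    resp : ∀ {β} → Inv t σ β → Inv t τ β
    resp = Inv-resp-≈W {σ} {τ} σ≈τ

  Listed-resp-≈W : {σ τ : Word t} → σ ≈W τ → Listed t σ → Listed t τ
  Listed-resp-≈W {σ} {τ} σ≈τ = Any.map λ {υ} → ≈W-trans {τ} {σ} {υ} (≈W-sym {σ} {τ} σ≈τ)

  ≈W⇒InvertsSumTriple⇔Listed : {σ τ : Word t} → σ ≈W τ →
    InvertsSumTriple t τ ⇔ Listed t τ → InvertsSumTriple t σ ⇔ Listed t σ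
  ≈W⇒InvertsSumTriple⇔Listed {σ} {τ} σ≈τ τ-equivalence = mk⇔
    (Listed-resp-≈W {τ} {σ} τ≈σ ∘ Equivalence.to τ-equivalence ∘ InvertsSumTriple-resp-≈W {σ} {τ} σ≈τ)
    (InvertsSumTriple-resp-≈W {τ} {σ} τ≈σ ∘ Equivalence.from τ-equivalence ∘ Listed-resp-≈W {σ} {τ} σ≈τ)
    where
    τ≈σ : τ ≈W σ
    τ≈σ = ≈W-sym {σ} {τ} σ≈τ

A1-has-no-sum-triple : {σ : Word A1} → ¬ InvertsSumTriple A1 σ
A1-has-no-sum-triple (_ , _ , (here refl , _) , (here refl , _) , (here () , _))
A1-has-no-sum-triple (_ , _ , (here refl , _) , (here refl , _) , (there () , _))

data Rank2 : Type → Set where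
  a2 : Rank2 A2
  b2 : Rank2 B2
  g2 : Rank2 G2

α₁ α₂ : ∀ {t} → Rank2 t → Vect t
α₁ a2 = + 1 ∷ + 0 ∷ []
α₁ b2 = + 1 ∷ + 0 ∷ []
α₁ g2 = + 1 ∷ + 0 ∷ []
α₂ a2 = + 0 ∷ + 1 ∷ []
α₂ b2 = + 0 ∷ + 1 ∷ []
α₂ g2 = + 0 ∷ + 1 ∷ []

infixr 5 _∷₂_

_∷₂_ : {a a′ b b′ : ℤ} → a ≡ a′ → b ≡ b′ → (Vec ℤ 2 ∋ a ∷ b ∷ []) ≡ a′ ∷ b′ ∷ []
a≡a′ ∷₂ b≡b′ = cong₂ _∷_ a≡a′ (cong (_∷ []) b≡b′)

first-coordinate : ∀ x y → x ≡ x * + 1 + y * + 0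
first-coordinate = solve-∀

second-coordinate : ∀ x y → y ≡ x * + 0 + y * + 1
second-coordinate = solve-∀

simple-roots-span : ∀ {t} (h : Rank2 t) (v : Vect t) →
                    ∃₂ λ x y → v ≡ x *ᵛ α₁ h +ᵛ y *ᵛ α₂ h
simple-roots-span a2 (x ∷ y ∷ []) = x , y , first-coordinate x y ∷₂ second-coordinate x y
simple-roots-span b2 (x ∷ y ∷ []) = x , y , first-coordinate x y ∷₂ second-coordinate x y
simple-roots-span g2 (x ∷ y ∷ []) = x , y , first-coordinate x y ∷₂ second-coordinate x y

-- The coordinates of s_i (x u + y w) with ⟨_, α_i^∨⟩ unfolded: u = (a, b), w = (c, d), and
-- (c₀, c₁) is the i-th column of the Cartan matrix.
reflected-coordinate-linear : ∀ c₀ c₁ x y a b c d e f →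
  (x * e + y * f) - ((x * a + y * c) * c₀ + ((x * b + y * d) * c₁ + 0ℤ))
    ≡ x * (e - (a * c₀ + (b * c₁ + 0ℤ))) + y * (f - (c * c₀ + (d * c₁ + 0ℤ)))
reflected-coordinate-linear = solve-∀

fixed-coordinate-linear : ∀ x y a c → (x * a + y * c) - 0ℤ ≡ x * (a - 0ℤ) + y * (c - 0ℤ)
fixed-coordinate-linear = solve-∀

reflect-linear : ∀ {t} → Rank2 t → (i : Fin (rank t)) (x y : ℤ) (u w : Vect t) →
                 reflect t i (x *ᵛ u +ᵛ y *ᵛ w) ≡ x *ᵛ reflect t i u +ᵛ y *ᵛ reflect t i w
reflect-linear a2 zero x y (a ∷ b ∷ []) (c ∷ d ∷ []) =
  reflected-coordinate-linear (+ 2) -[1+ 0 ] x y a b c d a c ∷₂ fixed-coordinate-linear x y b d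
reflect-linear a2 (suc zero) x y (a ∷ b ∷ []) (c ∷ d ∷ []) =
  fixed-coordinate-linear x y a c ∷₂ reflected-coordinate-linear -[1+ 0 ] (+ 2) x y a b c d b d
reflect-linear b2 zero x y (a ∷ b ∷ []) (c ∷ d ∷ []) =
  reflected-coordinate-linear (+ 2) -[1+ 0 ] x y a b c d a c ∷₂ fixed-coordinate-linear x y b d
reflect-linear b2 (suc zero) x y (a ∷ b ∷ []) (c ∷ d ∷ []) =
  fixed-coordinate-linear x y a c ∷₂ reflected-coordinate-linear -[1+ 1 ] (+ 2) x y a b c d b d
reflect-linear g2 zero x y (a ∷ b ∷ []) (c ∷ d ∷ []) =
  reflected-coordinate-linear (+ 2) -[1+ 0 ] x y a b c d a c ∷₂ fixed-coordinate-linear x y b d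
reflect-linear g2 (suc zero) x y (a ∷ b ∷ []) (c ∷ d ∷ []) =
  fixed-coordinate-linear x y a c ∷₂ reflected-coordinate-linear -[1+ 2 ] (+ 2) x y a b c d b d

act-linear : ∀ {t} → Rank2 t → (σ : Word t) (x y : ℤ) (u w : Vect t) →
             act t σ (x *ᵛ u +ᵛ y *ᵛ w) ≡ x *ᵛ act t σ u +ᵛ y *ᵛ act t σ w
act-linear h [] x y u w = refl
act-linear {t} h (i ∷ σ) x y u w =
  trans (cong (reflect t i) (act-linear h σ x y u w))
        (reflect-linear h i x y (act t σ u) (act t σ w))

module _ {t : Type} (h : Rank2 t) where

  ≈W-from-simple-roots : {σ τ : Word t} →
    act t σ (α₁ h) ≡ act t τ (α₁ h) → act t σ (α₂ h) ≡ act t τ (α₂ h) → σ ≈W τ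
  ≈W-from-simple-roots {σ} {τ} σα₁≡τα₁ σα₂≡τα₂ v with simple-roots-span h v
  ... | x , y , refl = begin
    act t σ (x *ᵛ α₁ h +ᵛ y *ᵛ α₂ h)             ≡⟨ act-linear h σ x y (α₁ h) (α₂ h) ⟩
    x *ᵛ act t σ (α₁ h) +ᵛ y *ᵛ act t σ (α₂ h)   ≡⟨ cong₂ (λ p q → x *ᵛ p +ᵛ y *ᵛ q) σα₁≡τα₁ σα₂≡τα₂ ⟩
    x *ᵛ act t τ (α₁ h) +ᵛ y *ᵛ act t τ (α₂ h)   ≡⟨ act-linear h τ x y (α₁ h) (α₂ h) ⟨
    act t τ (x *ᵛ α₁ h +ᵛ y *ᵛ α₂ h)             ∎
    where open ≡-Reasoning

  _≈W?_ : (σ τ : Word t) → Dec (σ ≈W τ)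
  σ ≈W? τ = map′ (λ (σα₁≡τα₁ , σα₂≡τα₂) → ≈W-from-simple-roots {σ} {τ} σα₁≡τα₁ σα₂≡τα₂)
                 (λ σ≈τ → σ≈τ (α₁ h) , σ≈τ (α₂ h))
                 (act t σ (α₁ h) ≟ᵛ act t τ (α₁ h) ×-dec act t σ (α₂ h) ≟ᵛ act t τ (α₂ h))

  listed? : (σ : Word t) → Dec (Listed t σ)
  listed? σ = any? (σ ≈W?_) (listed t)

weylGroup : ∀ {t} → Rank2 t → List (Word t)
weylGroup a2 =
  [] ∷ (s₁ ∷ []) ∷ (s₂ ∷ []) ∷ (s₁ ∷ s₂ ∷ []) ∷ (s₂ ∷ s₁ ∷ []) ∷ (s₁ ∷ s₂ ∷ s₁ ∷ []) ∷ []
weylGroup b2 =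
  [] ∷ (s₁ ∷ []) ∷ (s₂ ∷ []) ∷ (s₁ ∷ s₂ ∷ []) ∷ (s₂ ∷ s₁ ∷ []) ∷ (s₁ ∷ s₂ ∷ s₁ ∷ [])
  ∷ (s₂ ∷ s₁ ∷ s₂ ∷ []) ∷ (s₁ ∷ s₂ ∷ s₁ ∷ s₂ ∷ []) ∷ []
weylGroup g2 =
  [] ∷ (s₁ ∷ []) ∷ (s₂ ∷ []) ∷ (s₁ ∷ s₂ ∷ []) ∷ (s₂ ∷ s₁ ∷ []) ∷ (s₁ ∷ s₂ ∷ s₁ ∷ [])
  ∷ (s₂ ∷ s₁ ∷ s₂ ∷ []) ∷ (s₁ ∷ s₂ ∷ s₁ ∷ s₂ ∷ []) ∷ (s₂ ∷ s₁ ∷ s₂ ∷ s₁ ∷ [])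
  ∷ (s₁ ∷ s₂ ∷ s₁ ∷ s₂ ∷ s₁ ∷ []) ∷ (s₂ ∷ s₁ ∷ s₂ ∷ s₁ ∷ s₂ ∷ [])
  ∷ (s₁ ∷ s₂ ∷ s₁ ∷ s₂ ∷ s₁ ∷ s₂ ∷ []) ∷ []

InWeylGroup : ∀ {t} → Rank2 t → Word t → Set
InWeylGroup h σ = Any (σ ≈W_) (weylGroup h)

ClosedUnderSimpleReflections : ∀ {t} → Rank2 t → Set
ClosedUnderSimpleReflections h = All (λ τ → ∀ i → InWeylGroup h (i ∷ τ)) (weylGroup h)

closedUnderSimpleReflections? : ∀ {t} (h : Rank2 t) → Dec (ClosedUnderSimpleReflections h)
closedUnderSimpleReflections? h =
  all? (λ τ → Fin.all? λ i → any? (_≈W?_ h (i ∷ τ)) (weylGroup h)) (weylGroup h)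

weylGroup-closed : ∀ {t} (h : Rank2 t) → ClosedUnderSimpleReflections h
weylGroup-closed a2 = from-yes (closedUnderSimpleReflections? a2)
weylGroup-closed b2 = from-yes (closedUnderSimpleReflections? b2)
weylGroup-closed g2 = from-yes (closedUnderSimpleReflections? g2)

weylGroup-complete : ∀ {t} (h : Rank2 t) (σ : Word t) → InWeylGroup h σ
weylGroup-complete a2 [] = here λ _ → refl
weylGroup-complete b2 [] = here λ _ → refl
weylGroup-complete g2 [] = here λ _ → refl
weylGroup-complete h (i ∷ σ) with find (weylGroup-complete h σ)
... | τ , τ∈W , σ≈τ =
  Any.map (λ {υ} → ≈W-trans {σ = i ∷ σ} {i ∷ τ} {υ} (∷-cong-≈W i {σ} {τ} σ≈τ))
          (All.lookup (weylGroup-closed h) τ∈W i)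

InvertsSumTriple⇔Listed-on-weylGroup? : ∀ {t} (h : Rank2 t) →
  Dec (All (λ τ → InvertsSumTriple t τ ⇔ Listed t τ) (weylGroup h))
InvertsSumTriple⇔Listed-on-weylGroup? {t} h =
  all? (λ τ → invertsSumTriple? t τ ⇔? listed? h τ) (weylGroup h)

InvertsSumTriple⇔Listed-on-weylGroup : ∀ {t} (h : Rank2 t) →
  All (λ τ → InvertsSumTriple t τ ⇔ Listed t τ) (weylGroup h)
InvertsSumTriple⇔Listed-on-weylGroup a2 = from-yes (InvertsSumTriple⇔Listed-on-weylGroup? a2)
InvertsSumTriple⇔Listed-on-weylGroup b2 = from-yes (InvertsSumTriple⇔Listed-on-weylGroup? b2)
InvertsSumTriple⇔Listed-on-weylGroup g2 = from-yes (InvertsSumTriple⇔Listed-on-weylGroup? g2)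

rank2-invertsSumTriple⇔listed : ∀ {t} (h : Rank2 t) (σ : Word t) →
                                InvertsSumTriple t σ ⇔ Listed t σ
rank2-invertsSumTriple⇔listed h σ with find (weylGroup-complete h σ)
... | τ , τ∈W , σ≈τ =
  ≈W⇒InvertsSumTriple⇔Listed {σ = σ} {τ} σ≈τ
    (All.lookup (InvertsSumTriple⇔Listed-on-weylGroup h) τ∈W)

invertsSumTriple⇔listed : (t : Type) (σ : Word t) → InvertsSumTriple t σ ⇔ Listed t σ
invertsSumTriple⇔listed A1 σ = mk⇔ (⊥-elim ∘ A1-has-no-sum-triple {σ}) λ ()
invertsSumTriple⇔listed A2 = rank2-invertsSumTriple⇔listed a2
invertsSumTriple⇔listed B2 = rank2-invertsSumTriple⇔listed b2
invertsSumTriple⇔listed G2 = rank2-invertsSumTriple⇔listed g2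

lemma3p8 : (t : Type) (σ : Word t) → ContainsPattern A2 π₁ t σ ⇔ Listed t σ
lemma3p8 t σ = ⇔.trans (containsπ₁⇔invertsSumTriple t σ) (invertsSumTriple⇔listed t σ)
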